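{- Let $r,s>0$ and let $\mathbf{P}$ be a finite poset in $C(\{r,s\})$. Then $\dim(\mathbf{P})\le 5$.
   Context: An interval representation of a poset $(X,P)$ assigns to each $x\in X$ a closed real interval $[l_x,r_x]$ such that $x<y$ in $P$ iff $r_x<l_y$. $C(\{r,s\})$ is the class of posets having an interval representation in which every interval has length $r$ or $s$. The dimension $\dim(\mathbf{P})$ is the minimum number of linear extensions of $P$ whose intersection is $P$. -}

module Defs where

open import Level using (0ℓ)
open import Data.Nat using (ℕ; _≤_)
open import Data.Fin using (Fin)
open import Data.Product using (Σ; ∃; _×_; _,_)
open import Data.Sum using (_⊎_)
open import Relation.Nullary using (¬_)
open import Relation.Binary.PropositionalEquality using (_≡_)
open import Relation.Binary.Core using (Rel)
open import Relation.Binary.Structures using (IsStrictPartialOrder; IsStrictTotalOrder)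
open import Algebra.Structures using (IsCommutativeRing)

-- The real numbers, axiomatised as a Dedekind-complete ordered field.
-- (agda-stdlib has no reals; every model of this record is isomorphic
-- to ℝ, so quantifying over all models is the same as speaking of ℝ.)

record RealField : Set₁ where
  infixl 6 _+_
  infixl 7 _*_
  infix  4 _<_
  field
    ℝ   : Set
    _+_ _*_ : ℝ → ℝ → ℝ
    -_  : ℝ → ℝ
    0ℝ 1ℝ : ℝ
    _<_ : Rel ℝ 0ℓ
    isCommutativeRing : IsCommutativeRing _≡_ _+_ _*_ -_ 0ℝ 1ℝ
    0≢1 : ¬ (0ℝ ≡ 1ℝ)
    inverse : ∀ x → ¬ (x ≡ 0ℝ) → Σ ℝ λ y → x * y ≡ 1ℝ
    isStrictTotalOrder : IsStrictTotalOrder _≡_ _<_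
    +-mono-< : ∀ {x y} z → x < y → x + z < y + z
    *-pos : ∀ {x y} → 0ℝ < x → 0ℝ < y → 0ℝ < x * y
    complete : (S : ℝ → Set) → Σ ℝ S → (Σ ℝ λ b → ∀ x → S x → ¬ (b < x)) →
               Σ ℝ λ u → (∀ x → S x → ¬ (u < x)) ×
                         (∀ b → (∀ x → S x → ¬ (b < x)) → ¬ (b < u))

record FinPoset (n : ℕ) : Set₁ where
  field
    _≺_ : Rel (Fin n) 0ℓ
    isStrictPartialOrder : IsStrictPartialOrder _≡_ _≺_

module _ (R : RealField) where
  open RealField R

  -- An interval representation of P in which every interval [l x , l x + len x]
  -- has length r or s:  x < y in P  iff  right end of x < left end of y.
  record RSRepresentation {n : ℕ} (P : FinPoset n) (r s : ℝ) : Set where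
    open FinPoset P
    field
      left   : Fin n → ℝ
      len    : Fin n → ℝ
      len-rs : ∀ x → len x ≡ r ⊎ len x ≡ s
      repr   : ∀ x y → (x ≺ y → left x + len x < left y) × (left x + len x < left y → x ≺ y)

  InC : {n : ℕ} → FinPoset n → ℝ → ℝ → Set
  InC P r s = RSRepresentation P r s

record LinearExtension {n : ℕ} (P : FinPoset n) : Set₁ where
  open FinPoset P
  field
    _⊏_ : Rel (Fin n) 0ℓ
    isStrictTotalOrder : IsStrictTotalOrder _≡_ _⊏_
    extends : ∀ {x y} → x ≺ y → x ⊏ y

DimAtMost : {n : ℕ} → FinPoset n → ℕ → Set₁
DimAtMost {n} P d =
  Σ ℕ λ k → k ≤ d × Σ (Fin k → LinearExtension P) λ L →
    ∀ x y → (∀ i → LinearExtension._⊏_ (L i) x y) → FinPoset._≺_ P x y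

-- Within one length class the intervals have equal length; let β x be the height of x in the
-- strict order that P induces on its class. For equal-length x, y with left x < left y one has
-- β x ≤ β y, and β y ≤ β x + 1 when the intervals overlap. Sorting the elements by a point
-- chosen in each interval, with any tie-break, gives a linear extension of P; five of these
-- suffice, since every overlapping pair x ≠ y is reversed by one of:
--   * two extensions placing one length class at right and the other at left endpoints; they
--     reverse pairs of different lengths, and same-length pairs ordered by left endpoint or tied;
--   * one extension placing each block {same length, same β}, whose intervals pairwise overlap,
--     at a common point (the largest left endpoint in the block), sorted inside by decreasing
--     left endpoint;
--   * two extensions placing the elements of odd, resp. even, β at right endpoints; they reverse
--     the overlapping pairs with β y = β x + 1.

module Submission where

open import Defs
open import Level using (0ℓ)
open import Data.Bool.Base using (Bool; true; false; not; f<t)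
import Data.Bool.Properties as Bool
open import Data.Fin using (Fin; #_) renaming (_<_ to _<ᶠ_)
import Data.Fin.Properties as Fin
open import Data.Fin.Subset using (Subset; ∣_∣; _∈_)
open import Data.Fin.Subset.Properties using (p⊂q⇒∣p∣<∣q∣; ∣p∣≤n)
open import Data.List.Base using (map; filter; allFin)
open import Data.List.Membership.Propositional.Properties using (∈-filter⁺; ∈-filter⁻; ∈-allFin; ∈-map⁺)
import Data.List.Relation.Unary.All as All
import Data.List.Relation.Unary.All.Properties as AllP
import Data.List.Extrema as Extrema
open import Data.Nat.Base as ℕ using (ℕ; zero; suc; z≤n; s≤s)
import Data.Nat.Properties as ℕ
open import Data.Product.Base using (∃; _×_; _,_; proj₁; proj₂)
open import Data.Product.Properties using (≡-dec)
open import Data.Product.Relation.Binary.Lex.Strict using (×-Lex; ×-isStrictTotalOrder)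
open import Data.Sum.Base using (_⊎_; inj₁; inj₂; [_,_]′)
open import Data.Vec.Base using (Vec; []; _∷_; lookup; tabulate)
open import Data.Vec.Properties using (lookup⇒[]=; []=⇒lookup; lookup∘tabulate)
open import Function.Base using (_∘_; flip; _on_)
open import Relation.Binary.Bundles using (TotalOrder)
open import Relation.Binary.Core using (Rel; _⇒_)
open import Relation.Binary.Definitions using (Decidable; Transitive; Tri; tri<; tri≈; tri>)
open import Relation.Binary.PropositionalEquality using (_≡_; _≢_; refl; sym; trans; cong; cong₂; subst; subst₂; isEquivalence)
open import Relation.Binary.Structures using (IsStrictTotalOrder; IsStrictPartialOrder)
import Relation.Binary.Construct.On as On
import Relation.Binary.Construct.Flip.EqAndOrd as Flip
import Relation.Binary.Construct.StrictToNonStrict as StrictToNonStrict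
open import Relation.Nullary.Decidable using (Dec; yes; no; does; dec-true; _×-dec_; map′)
open import Relation.Nullary.Negation using (¬_; contradiction)
import Relation.Unary as U
open import Algebra.Structures using (IsCommutativeRing)

module _ {A : Set} where

  isStrictTotalOrder-≡ : {_≈_ _<_ : Rel A 0ℓ} → IsStrictTotalOrder _≈_ _<_ → _≈_ ⇒ _≡_ →
                         IsStrictTotalOrder _≡_ _<_
  isStrictTotalOrder-≡ {_≈_} {_<_} sto ≈⇒≡ = record
    { isStrictPartialOrder = record
      { isEquivalence = isEquivalence
      ; irrefl = λ { refl → S.irrefl S.Eq.refl }
      ; trans = S.trans
      ; <-resp-≈ = (λ { refl p → p }) , (λ { refl p → p }) }
    ; compare = compare }
    where
    module S = IsStrictTotalOrder sto
    compare : ∀ x y → Tri (x < y) (x ≡ y) (y < x)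
    compare x y with S.compare x y
    ... | tri< a ¬b ¬c = tri< a (λ { refl → ¬b S.Eq.refl }) ¬c
    ... | tri≈ ¬a b ¬c = tri≈ ¬a (≈⇒≡ b) ¬c
    ... | tri> ¬a ¬b c = tri> ¬a (λ { refl → ¬b S.Eq.refl }) c

  Refine : {B : Set} → (A → B) → Rel B 0ℓ → Rel A 0ℓ → Rel A 0ℓ
  Refine f _<_ _⊏_ = ×-Lex _≡_ _<_ _⊏_ on (λ x → f x , x)

  refine-isStrictTotalOrder : {B : Set} {_<_ : Rel B 0ℓ} {_⊏_ : Rel A 0ℓ} (f : A → B) →
                              IsStrictTotalOrder _≡_ _<_ → IsStrictTotalOrder _≡_ _⊏_ →
                              IsStrictTotalOrder _≡_ (Refine f _<_ _⊏_)
  refine-isStrictTotalOrder f <-sto ⊏-sto =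
    isStrictTotalOrder-≡ (On.isStrictTotalOrder (λ x → f x , x) (×-isStrictTotalOrder <-sto ⊏-sto)) proj₂

module FiniteSup {b ℓ₁ ℓ₂} (O : TotalOrder b ℓ₁ ℓ₂) where
  open TotalOrder O renaming (Carrier to B)
  open Extrema O using (max; xs≤max; max≤v⁺)

  module _ {n} {P : U.Pred (Fin n) 0ℓ} (P? : U.Decidable P) where

    sup : (Fin n → B) → B → B
    sup f ⊥ = max ⊥ (map f (filter P? (allFin n)))

    f≤sup : ∀ {f ⊥ w} → P w → f w ≤ sup f ⊥
    f≤sup {f} {⊥} {w} pw =
      All.lookup (xs≤max ⊥ (map f (filter P? (allFin n)))) (∈-map⁺ f (∈-filter⁺ P? (∈-allFin w) pw))

    sup≤v : ∀ {f ⊥ v} → ⊥ ≤ v → (∀ {w} → P w → f w ≤ v) → sup f ⊥ ≤ v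
    sup≤v ⊥≤v f≤v =
      max≤v⁺ ⊥≤v (AllP.map⁺ (All.tabulate λ w∈ → f≤v (proj₂ (∈-filter⁻ P? {xs = allFin n} w∈))))

module Height {n} {_◁_ : Rel (Fin n) 0ℓ} (_◁?_ : Decidable _◁_)
              (◁-trans : Transitive _◁_) (◁-irrefl : ∀ {x} → ¬ x ◁ x) where
  open FiniteSup ℕ.≤-totalOrder

  below : Fin n → Subset n
  below x = tabulate (λ w → does (w ◁? x))

  ∈-below⁺ : ∀ {w x} → w ◁ x → w ∈ below x
  ∈-below⁺ {w} {x} w◁x =
    lookup⇒[]= w (below x) (trans (lookup∘tabulate _ w) (dec-true (w ◁? x) w◁x))

  ∈-below⁻ : ∀ {w x} → w ∈ below x → w ◁ x
  ∈-below⁻ {w} {x} w∈ with w ◁? x | trans (sym (lookup∘tabulate _ w)) ([]=⇒lookup w∈)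
  ... | yes w◁x | _ = w◁x
  ... | no _    | ()

  rank : Fin n → ℕ
  rank x = ∣ below x ∣

  rank-< : ∀ {w x} → w ◁ x → rank w ℕ.< rank x
  rank-< {w} {x} w◁x = p⊂q⇒∣p∣<∣q∣
    ( (λ u∈ → ∈-below⁺ (◁-trans (∈-below⁻ u∈) w◁x))
    , w , ∈-below⁺ w◁x , λ w∈ → ◁-irrefl (∈-below⁻ w∈))

  -- h t x is the height of x counting only chains of at most t steps; since rank strictly
  -- increases along ◁, it no longer changes once t exceeds rank x.
  private
    h : ℕ → Fin n → ℕ
    h zero    x = 0
    h (suc t) x = sup (_◁? x) (suc ∘ h t) 0

    h-ub : ∀ t {w x} → w ◁ x → suc (h t w) ℕ.≤ h (suc t) x
    h-ub t {x = x} = f≤sup (_◁? x)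

    h-lub : ∀ t {x B} → (∀ {w} → w ◁ x → suc (h t w) ℕ.≤ B) → h (suc t) x ℕ.≤ B
    h-lub t {x = x} = sup≤v (_◁? x) z≤n

    h-incr : ∀ t x → h t x ℕ.≤ h (suc t) x
    h-incr zero    x = z≤n
    h-incr (suc t) x = h-lub t λ {w} w◁x → ℕ.≤-trans (s≤s (h-incr t w)) (h-ub (suc t) w◁x)

    h-stable : ∀ t x → rank x ℕ.< t → h (suc t) x ℕ.≤ h t x
    h-stable (suc t) x rx<t = h-lub (suc t) λ {w} w◁x →
      ℕ.≤-trans (s≤s (h-stable t w (ℕ.<-≤-trans (rank-< w◁x) (ℕ.≤-pred rx<t)))) (h-ub t w◁x)

  height : Fin n → ℕ
  height = h (suc n)

  height-< : ∀ {w x} → w ◁ x → height w ℕ.< height x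
  height-< {w} w◁x =
    ℕ.≤-trans (s≤s (h-stable n w (ℕ.<-≤-trans (rank-< w◁x) (∣p∣≤n (below _))))) (h-ub n w◁x)

  height-lub : ∀ {x B} → (∀ {w} → w ◁ x → height w ℕ.< B) → height x ℕ.≤ B
  height-lub hyp = h-lub n λ {w} w◁x → ℕ.≤-trans (s≤s (h-incr n w)) (hyp w◁x)

  height-mono : ∀ {x y} → (∀ {w} → w ◁ x → w ◁ y) → height x ℕ.≤ height y
  height-mono below⊆ = height-lub λ w◁x → height-< (below⊆ w◁x)

module RealOrder (R : RealField) where
  open RealField R
  private module STO = IsStrictTotalOrder isStrictTotalOrder

  open StrictToNonStrict _≡_ _<_ public using (_≤_)

  ≤-totalOrder : TotalOrder 0ℓ 0ℓ 0ℓ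
  ≤-totalOrder = record { isTotalOrder = StrictToNonStrict.isTotalOrder _≡_ _<_ isStrictTotalOrder }

  open TotalOrder ≤-totalOrder public using () renaming (refl to ≤-refl; antisym to ≤-antisym)

  <-≤-trans : ∀ {a b c} → a < b → b ≤ c → a < c
  <-≤-trans = StrictToNonStrict.<-≤-trans _≡_ _<_ STO.trans STO.<-respʳ-≈

  ≤-<-trans : ∀ {a b c} → a ≤ b → b < c → a < c
  ≤-<-trans = StrictToNonStrict.≤-<-trans _≡_ _<_ STO.Eq.sym STO.trans STO.<-respˡ-≈

  ≮⇒≥ : ∀ {a b} → ¬ a < b → b ≤ a
  ≮⇒≥ {a} {b} a≮b with STO.compare a b
  ... | tri< a<b _ _ = contradiction a<b a≮b
  ... | tri≈ _ a≡b _ = inj₂ (sym a≡b)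
  ... | tri> _ _ b<a = inj₁ b<a

module IntervalOrder (R : RealField) {n} (P : FinPoset n) where
  open RealField R
  open RealOrder R
  open FinPoset P

  _⊏⟨_⟩_ : Fin n → LinearExtension P → Fin n → Set
  x ⊏⟨ L ⟩ y = LinearExtension._⊏_ L x y

  ⊏-asym : ∀ L {x y} → x ⊏⟨ L ⟩ y → ¬ y ⊏⟨ L ⟩ x
  ⊏-asym L = IsStrictTotalOrder.asym (LinearExtension.isStrictTotalOrder L)

  module WithEndpoints (lf rt : Fin n → ℝ) (lf≤rt : ∀ x → lf x ≤ rt x)
                       (≺⇒< : ∀ {x y} → x ≺ y → rt x < lf y) where

    pointExtension : (Q : Fin n → ℝ) → (∀ x → lf x ≤ Q x) → (∀ x → Q x ≤ rt x) →
                     {_⊏_ : Rel (Fin n) 0ℓ} → IsStrictTotalOrder _≡_ _⊏_ → LinearExtension P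
    pointExtension Q lf≤Q Q≤rt {_⊏_} ⊏-sto = record
      { _⊏_ = Refine Q _<_ _⊏_
      ; isStrictTotalOrder = refine-isStrictTotalOrder Q isStrictTotalOrder ⊏-sto
      ; extends = λ {x} {y} x≺y → inj₁ (≤-<-trans (Q≤rt x) (<-≤-trans (≺⇒< x≺y) (lf≤Q y))) }

    endpoint : Bool → Fin n → ℝ
    endpoint false = lf
    endpoint true  = rt

    sidedExtension : (side : Fin n → Bool) → {_⊏_ : Rel (Fin n) 0ℓ} → IsStrictTotalOrder _≡_ _⊏_ →
                     LinearExtension P
    sidedExtension side ⊏-sto = pointExtension (λ x → endpoint (side x) x) lf≤endpoint endpoint≤rt
      (refine-isStrictTotalOrder side Bool.<-isStrictTotalOrder ⊏-sto)
      where
      lf≤endpoint : ∀ x → lf x ≤ endpoint (side x) x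
      lf≤endpoint x with side x
      ... | false = ≤-refl
      ... | true  = lf≤rt x
      endpoint≤rt : ∀ x → endpoint (side x) x ≤ rt x
      endpoint≤rt x with side x
      ... | false = lf≤rt x
      ... | true  = ≤-refl

    sided-ordered : ∀ side {_⊏_} (⊏-sto : IsStrictTotalOrder _≡_ _⊏_) {x y} → side x ≡ side y →
                    endpoint (side y) x < endpoint (side y) y → x ⊏⟨ sidedExtension side ⊏-sto ⟩ y
    sided-ordered side ⊏-sto sx≡sy ex<ey rewrite sx≡sy = inj₁ ex<ey

    sided-tied : ∀ side {_⊏_} (⊏-sto : IsStrictTotalOrder _≡_ _⊏_) {x y} → side x ≡ side y →
                 endpoint (side y) x ≡ endpoint (side y) y → x ⊏ y → x ⊏⟨ sidedExtension side ⊏-sto ⟩ y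
    sided-tied side ⊏-sto sx≡sy ex≡ey x⊏y rewrite sx≡sy = inj₂ (ex≡ey , inj₂ (refl , x⊏y))

    sided-reverses : ∀ side {_⊏_} (⊏-sto : IsStrictTotalOrder _≡_ _⊏_) {x y} →
                     side x ≡ true → side y ≡ false → lf y ≤ rt x → y ⊏⟨ sidedExtension side ⊏-sto ⟩ x
    sided-reverses side ⊏-sto {x} {y} sx sy ly≤rx rewrite sx | sy with ly≤rx
    ... | inj₁ ly<rx = inj₁ ly<rx
    ... | inj₂ ly≡rx = inj₂ (ly≡rx , inj₁ f<t)

odd : ℕ → Bool
odd zero    = false
odd (suc k) = not (odd k)

module TwoLengths (R : RealField) (r s : RealField.ℝ R)
                  (0<r : RealField._<_ R (RealField.0ℝ R) r) (0<s : RealField._<_ R (RealField.0ℝ R) s)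
                  {n : ℕ} (P : FinPoset n) (rep : InC R P r s) where
  open RealField R
  open RealOrder R
  open FinPoset P
  open RSRepresentation rep renaming (left to lf)
  open IsCommutativeRing isCommutativeRing using (+-comm; +-identityˡ)
  private
    module STO = IsStrictTotalOrder isStrictTotalOrder
    module PO = IsStrictPartialOrder isStrictPartialOrder

  rt : Fin n → ℝ
  rt x = lf x + len x

  lf<rt : ∀ x → lf x < rt x
  lf<rt x = subst₂ _<_ (+-identityˡ (lf x)) (+-comm (len x) (lf x)) (+-mono-< (lf x) 0<len)
    where
    0<len : 0ℝ < len x
    0<len with len-rs x
    ... | inj₁ len≡r = subst (0ℝ <_) (sym len≡r) 0<r
    ... | inj₂ len≡s = subst (0ℝ <_) (sym len≡s) 0<s

  ≺⇒< : ∀ {x y} → x ≺ y → rt x < lf y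
  ≺⇒< {x} {y} = proj₁ (repr x y)

  <⇒≺ : ∀ {x y} → rt x < lf y → x ≺ y
  <⇒≺ {x} {y} = proj₂ (repr x y)

  open IntervalOrder R P
  open WithEndpoints lf rt (λ x → inj₁ (lf<rt x)) ≺⇒<

  long : Fin n → Bool
  long x = does (len x STO.≟ s)

  long-cong : ∀ {x y} → len x ≡ len y → long x ≡ long y
  long-cong e = cong (λ l → does (l STO.≟ s)) e

  len-determined : ∀ {x y} → long x ≡ long y → len x ≡ len y
  len-determined {x} {y} lx≡ly with len x STO.≟ s | len y STO.≟ s | len-rs x | len-rs y
  ... | yes x≡s | yes y≡s | _         | _         = trans x≡s (sym y≡s)
  ... | no _    | no _    | inj₁ x≡r  | inj₁ y≡r  = trans x≡r (sym y≡r)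
  ... | no x≢s  | _       | inj₂ x≡s  | _         = contradiction x≡s x≢s
  ... | _       | no y≢s  | _         | inj₂ y≡s  = contradiction y≡s y≢s

  rt-< : ∀ {x y} → len x ≡ len y → lf x < lf y → rt x < rt y
  rt-< {x} {y} e lx<ly = subst (λ l → lf x + len x < lf y + l) e (+-mono-< (len x) lx<ly)

  rt-<⁻ : ∀ {x y} → len x ≡ len y → rt x < rt y → lf x < lf y
  rt-<⁻ {x} {y} e rx<ry with STO.compare (lf x) (lf y)
  ... | tri< lx<ly _ _ = lx<ly
  ... | tri≈ _ lx≡ly _ = contradiction rx<ry (STO.irrefl (cong₂ _+_ lx≡ly e))
  ... | tri> _ _ ly<lx = contradiction rx<ry (STO.asym (rt-< (sym e) ly<lx))

  _◁_ : Rel (Fin n) 0ℓ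
  w ◁ x = len w ≡ len x × w ≺ x

  _◁?_ : Decidable _◁_
  w ◁? x = (len w STO.≟ len x) ×-dec map′ <⇒≺ ≺⇒< (rt w STO.<? lf x)

  open Height _◁?_ (λ (e , w≺x) (e′ , x≺y) → trans e e′ , PO.trans w≺x x≺y)
                    (λ (_ , x≺x) → PO.irrefl refl x≺x)
    renaming (height to β)

  β-mono : ∀ {x y} → len x ≡ len y → lf x < lf y → β x ℕ.≤ β y
  β-mono lx≡ly lx<ly =
    height-mono λ (lw≡lx , w≺x) → trans lw≡lx lx≡ly , <⇒≺ (STO.trans (≺⇒< w≺x) lx<ly)

  β-overlap : ∀ {x y} → len x ≡ len y → lf y ≤ rt x → β y ℕ.≤ suc (β x)
  β-overlap lx≡ly ly≤rx = height-lub λ (lz≡ly , z≺y) →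
    let lz≡lx = trans lz≡ly (sym lx≡ly) in
    s≤s (β-mono lz≡lx (rt-<⁻ lz≡lx (<-≤-trans (≺⇒< z≺y) ly≤rx)))

  label : Fin n → ℝ × ℕ
  label x = len x , β x

  inBlockOf? : ∀ x → U.Decidable (λ w → label w ≡ label x)
  inBlockOf? x w = ≡-dec STO._≟_ ℕ._≟_ (label w) (label x)

  open FiniteSup ≤-totalOrder

  blockTop : Fin n → ℝ
  blockTop x = sup (inBlockOf? x) lf (lf x)

  lf≤blockTop : ∀ x → lf x ≤ blockTop x
  lf≤blockTop x = f≤sup (inBlockOf? x) refl

  blockTop≤rt : ∀ x → blockTop x ≤ rt x
  blockTop≤rt x = sup≤v (inBlockOf? x) (inj₁ (lf<rt x)) λ lw≡lx →
    ≮⇒≥ λ rx<lw → ℕ.<-irrefl (sym (cong proj₂ lw≡lx)) (height-< (sym (cong proj₁ lw≡lx) , <⇒≺ rx<lw))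

  blockTop-≤ : ∀ {x y} → label x ≡ label y → blockTop x ≤ blockTop y
  blockTop-≤ {x} {y} lx≡ly = sup≤v (inBlockOf? x)
    (f≤sup (inBlockOf? y) lx≡ly)
    (λ lw≡lx → f≤sup (inBlockOf? y) (trans lw≡lx lx≡ly))

  blockTop-cong : ∀ {x y} → label x ≡ label y → blockTop x ≡ blockTop y
  blockTop-cong lx≡ly = ≤-antisym (blockTop-≤ lx≡ly) (blockTop-≤ (sym lx≡ly))

  ascending : IsStrictTotalOrder _≡_ (_<ᶠ_ {n})
  ascending = Fin.<-isStrictTotalOrder

  descending : IsStrictTotalOrder _≡_ (flip (_<ᶠ_ {n}))
  descending = Flip.isStrictTotalOrder Fin.<-isStrictTotalOrder

  blockExtension : LinearExtension P
  blockExtension = pointExtension blockTop lf≤blockTop blockTop≤rt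
    (refine-isStrictTotalOrder lf (Flip.isStrictTotalOrder isStrictTotalOrder) ascending)

  extensions : Vec (LinearExtension P) 5
  extensions = sidedExtension long ascending
             ∷ sidedExtension (not ∘ long) descending
             ∷ blockExtension
             ∷ sidedExtension (odd ∘ β) ascending
             ∷ sidedExtension (not ∘ odd ∘ β) ascending
             ∷ []

  Reversed : Fin n → Fin n → Set
  Reversed x y = ∃ λ i → y ⊏⟨ lookup extensions i ⟩ x

  endpoint-< : ∀ {x y} → len x ≡ len y → lf x < lf y → ∀ b → endpoint b x < endpoint b y
  endpoint-< e lx<ly false = lx<ly
  endpoint-< e lx<ly true  = rt-< e lx<ly

  endpoint-≡ : ∀ {x y} → len x ≡ len y → lf x ≡ lf y → ∀ b → endpoint b x ≡ endpoint b y
  endpoint-≡ e lx≡ly false = lx≡ly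
  endpoint-≡ e lx≡ly true  = cong₂ _+_ lx≡ly e

  reversed-by-parity : ∀ {x y} → β y ≡ suc (β x) → lf y ≤ rt x → Reversed x y
  reversed-by-parity {x} {y} βy≡1+βx ly≤rx = by (odd (β x)) refl
    where
    odd-βy : odd (β y) ≡ not (odd (β x))
    odd-βy = cong odd βy≡1+βx
    by : ∀ b → odd (β x) ≡ b → Reversed x y
    by true  ox = # 3 , sided-reverses (odd ∘ β) ascending ox (trans odd-βy (cong not ox)) ly≤rx
    by false ox = # 4 , sided-reverses (not ∘ odd ∘ β) ascending
                          (cong not ox) (cong not (trans odd-βy (cong not ox))) ly≤rx

  reversed-in-block : ∀ {x y} → label x ≡ label y → lf x < lf y → Reversed x y
  reversed-in-block lx≡ly lx<ly = # 2 , inj₂ (blockTop-cong (sym lx≡ly) , inj₁ lx<ly)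

  reversed-by-height : ∀ {x y} → len x ≡ len y → lf x < lf y → lf y ≤ rt x → Reversed x y
  reversed-by-height lx≡ly lx<ly ly≤rx =
    [ (λ βx<βy → reversed-by-parity (ℕ.≤-antisym (β-overlap lx≡ly ly≤rx) βx<βy) ly≤rx)
    , (λ βx≡βy → reversed-in-block (cong₂ _,_ lx≡ly βx≡βy) lx<ly)
    ]′ (ℕ.m≤n⇒m<n∨m≡n (β-mono lx≡ly lx<ly))

  reversed-identical : ∀ {x y} → x ≢ y → len x ≡ len y → lf x ≡ lf y → Reversed x y
  reversed-identical {x} {y} x≢y lx≡ly lx≡ly′ = by (Fin.<-cmp y x)
    where
    ex≡ey : ∀ b → endpoint b y ≡ endpoint b x
    ex≡ey = endpoint-≡ (sym lx≡ly) (sym lx≡ly′)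
    by : Tri (y <ᶠ x) (y ≡ x) (x <ᶠ y) → Reversed x y
    by (tri< y<x _ _) = # 0 , sided-tied long ascending (long-cong (sym lx≡ly)) (ex≡ey (long x)) y<x
    by (tri≈ _ y≡x _) = contradiction (sym y≡x) x≢y
    by (tri> _ _ x<y) = # 1 , sided-tied (not ∘ long) descending
                                (cong not (long-cong (sym lx≡ly))) (ex≡ey (not (long x))) x<y

  reversed-same-length : ∀ {x y} → x ≢ y → len x ≡ len y → lf y ≤ rt x → Reversed x y
  reversed-same-length {x} {y} x≢y lx≡ly ly≤rx = by (STO.compare (lf x) (lf y))
    where
    by : Tri (lf x < lf y) (lf x ≡ lf y) (lf y < lf x) → Reversed x y
    by (tri< lx<ly _ _) = reversed-by-height lx≡ly lx<ly ly≤rx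
    by (tri≈ _ lx≡ly′ _) = reversed-identical x≢y lx≡ly lx≡ly′
    by (tri> _ _ ly<lx) = # 0 , sided-ordered long ascending
                                  (long-cong (sym lx≡ly)) (endpoint-< (sym lx≡ly) ly<lx (long x))

  overlapping-reversed : ∀ {x y} → x ≢ y → lf y ≤ rt x → Reversed x y
  overlapping-reversed {x} {y} x≢y ly≤rx = by (long x) (long y) refl refl
    where
    by : ∀ a b → long x ≡ a → long y ≡ b → Reversed x y
    by true  false lx ly = # 0 , sided-reverses long ascending lx ly ly≤rx
    by false true  lx ly = # 1 , sided-reverses (not ∘ long) descending (cong not lx) (cong not ly) ly≤rx
    by true  true  lx ly = reversed-same-length x≢y (len-determined (trans lx (sym ly))) ly≤rx
    by false false lx ly = reversed-same-length x≢y (len-determined (trans lx (sym ly))) ly≤rx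

  realizes : ∀ x y → (∀ i → x ⊏⟨ lookup extensions i ⟩ y) → x ≺ y
  realizes x y x⊏y = by (rt x STO.<? lf y) (x Fin.≟ y)
    where
    by : Dec (rt x < lf y) → Dec (x ≡ y) → x ≺ y
    by (yes rx<ly) _          = <⇒≺ rx<ly
    by (no rx≮ly)  (yes refl) = contradiction (x⊏y (# 0)) (λ x⊏x → ⊏-asym (lookup extensions (# 0)) x⊏x x⊏x)
    by (no rx≮ly)  (no x≢y)   = let i , y⊏x = overlapping-reversed x≢y (≮⇒≥ rx≮ly) in
                                contradiction y⊏x (⊏-asym (lookup extensions i) (x⊏y i))

  dimension≤5 : DimAtMost P 5
  dimension≤5 = 5 , ℕ.≤-refl , lookup extensions , realizes

proposition6p1 : (R : RealField) (r s : RealField.ℝ R) →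
                 RealField._<_ R (RealField.0ℝ R) r →
                 RealField._<_ R (RealField.0ℝ R) s →
                 {n : ℕ} (P : FinPoset n) →
                 InC R P r s →
                 DimAtMost P 5
proposition6p1 R r s 0<r 0<s P rep = TwoLengths.dimension≤5 R r s 0<r 0<s P rep
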